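{- For $n\geq 1$ let $\psi_n(x)=\sum_{k=0}^{n-1}op_{n,\geq k}\,x^k$, where $op_{n,\geq k}$ is the number of ordered preference sets of length $n$ with at least $k$ flaws. Then for every $n\geq 2$, $$2x\,\psi_n(x)=2(1+x)^2\psi_{n-1}(x)+(x-1)\binom{2n-2}{n-1}.$$
   Context: Parking model: $n$ parking spaces numbered $1,\dots,n$ from left to right; a preference set of length $n$ is a sequence $(a_1,\dots,a_n)$ with $a_i\in[n]$. Cars arrive in order; car $i$ goes to space $a_i$, and if it is occupied, moves to the first unoccupied space to the right; if there is none, the car cannot park. The number of flaws is the number of cars that cannot park. A preference set is ordered if $a_1\leq\cdots\leq a_n$. -}

module Defs where

open import Data.Nat using (ℕ; zero; suc; _∸_; _≤ᵇ_; _≡ᵇ_)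
open import Data.Bool using (Bool; true; false; if_then_else_; _∧_; _∨_)
open import Data.Fin using (Fin; toℕ)
open import Data.List using (List; []; _∷_; length; filterᵇ; map; concatMap; upTo; allFin)
open import Data.Integer as ℤ using (ℤ)
open import Data.Product using (_×_; _,_; proj₂)
open import Data.Maybe using (Maybe; just; nothing)
open import Function using (_∘_)

-- Parking model.  Spaces are 0,…,n-1 (i.e. space i+1 of the paper is
-- index i).  A preference set of length n is a list of n elements of Fin n.

allPrefs : (m n : ℕ) → List (List (Fin n))
allPrefs zero    n = [] ∷ []
allPrefs (suc m) n = concatMap (λ a → map (a ∷_) (allPrefs m n)) (allFin n)

memb : ℕ → List ℕ → Bool
memb x []       = false
memb x (y ∷ ys) = (x ≡ᵇ y) ∨ memb x ys

freeFrom : List ℕ → ℕ → ℕ → Maybe ℕ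
freeFrom occ j zero    = nothing
freeFrom occ j (suc f) = if memb j occ then freeFrom occ (suc j) f else just j

-- run the cars in order; state = (occupied spaces, number of flaws)
parkAll : (n : ℕ) → List (Fin n) → List ℕ × ℕ → List ℕ × ℕ
parkAll n []       st = st
parkAll n (a ∷ as) (occ , fl) with freeFrom occ (toℕ a) (n ∸ toℕ a)
... | just j  = parkAll n as (j ∷ occ , fl)
... | nothing = parkAll n as (occ , suc fl)

flaws : (n : ℕ) → List (Fin n) → ℕ
flaws n p = proj₂ (parkAll n p ([] , 0))

isOrdered : {n : ℕ} → List (Fin n) → Bool
isOrdered []           = true
isOrdered (a ∷ [])     = true
isOrdered (a ∷ b ∷ as) = (toℕ a ≤ᵇ toℕ b) ∧ isOrdered (b ∷ as)

op≥ : ℕ → ℕ → ℕ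
op≥ n k = length (filterᵇ (λ p → isOrdered p ∧ (k ≤ᵇ flaws n p)) (allPrefs n n))

-- Integer polynomials as coefficient lists (constant term first).

Poly : Set
Poly = List ℤ

coeff : Poly → ℕ → ℤ
coeff []       k       = ℤ.0ℤ
coeff (c ∷ cs) zero    = c
coeff (c ∷ cs) (suc k) = coeff cs k

infixl 6 _+ₚ_
infixl 7 _*ₚ_ _·ₚ_

_+ₚ_ : Poly → Poly → Poly
[]       +ₚ q        = q
(c ∷ cs) +ₚ []       = c ∷ cs
(c ∷ cs) +ₚ (d ∷ ds) = (c ℤ.+ d) ∷ (cs +ₚ ds)

_·ₚ_ : ℤ → Poly → Poly
a ·ₚ p = map (a ℤ.*_) p

_*ₚ_ : Poly → Poly → Poly
[]       *ₚ q = []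
(c ∷ cs) *ₚ q = (c ·ₚ q) +ₚ (ℤ.0ℤ ∷ (cs *ₚ q))

_≈ₚ_ : Poly → Poly → Set
p ≈ₚ q = ∀ k → coeff p k ≡ coeff q k
  where open import Relation.Binary.PropositionalEquality using (_≡_)

X : Poly
X = ℤ.0ℤ ∷ ℤ.1ℤ ∷ []

const : ℤ → Poly
const a = a ∷ []

ψ : ℕ → Poly
ψ n = map (λ k → ℤ.+ (op≥ n k)) (upTo n)

-- Along an ordered preference list the cars that have parked at or above the current preference fill one
-- block, so the process is governed by the current preference, the first free space and the number of flaws
-- so far. Splitting by the first preference, the number of ordered lists with at least k flaws obeys a
-- Pascal-type recursion in the remaining cars and spaces; the closed form flawCount obeys the same one, which
-- gives op_{n,≥k} = C(2n-1, n+k). The recurrence for ψ_n is then Pascal's rule applied twice,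
-- C(2n-1, n+k) = C(2n-3, n+k-2) + 2 C(2n-3, n+k-1) + C(2n-3, n+k), read coefficientwise, with the constant
-- term settled by C(2n-3, n-2) = C(2n-3, n-1) and C(2n-2, n-1) = 2 C(2n-3, n-1).

module Submission where

open import Defs
open import Data.Bool using (Bool; true; false; if_then_else_; _∧_; _∨_)
open import Data.Fin as Fin using (Fin; toℕ)
open import Data.List using (List; []; _∷_; _++_; length; map; concatMap; filterᵇ; tabulate; applyUpTo; allFin)
open import Data.List.Properties using (filter-++; length-++; map-tabulate; map-upTo)
open import Data.Maybe using (Maybe; just; nothing)
open import Data.Nat
  using (ℕ; zero; suc; _+_; _*_; _∸_; _≤_; _<_; _≤ᵇ_; _≟_; pred; z≤n; s≤s; s≤s⁻¹; z<s)
open import Data.Nat.Combinatorics using (_C_; k>n⇒nCk≡0; nCk+nC[k+1]≡[n+1]C[k+1]; nCk≡nC[n∸k])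
open import Data.Nat.ListAction using (sum)
open import Data.Nat.Properties
import Data.Nat.Tactic.RingSolver as ℕ-Ring
open import Data.Integer as ℤ using (ℤ; +_; 0ℤ; 1ℤ; -1ℤ)
import Data.Integer.Properties as ℤP
open import Data.Integer.Tactic.RingSolver using (solve-∀)
open import Data.Product using (_×_; _,_; proj₂; uncurry)
open import Data.Sum using (inj₁; inj₂)
open import Function using (_∘_; id)
open import Relation.Binary.PropositionalEquality
open import Relation.Nullary using (does; yes; no; contradiction)
open import Relation.Nullary.Decidable using (dec-true; dec-false; T?)

pascal : ∀ n k → suc n C suc k ≡ n C k + n C suc k
pascal n k = sym (nCk+nC[k+1]≡[n+1]C[k+1] n k)

forced : ℕ → ℕ → ℕ → ℕ
forced m L d = m ∸ (L ∸ d)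

orderedCount : ℕ → ℕ → ℕ
orderedCount m L = pred (m + L) C m

reflectedCount : ℕ → ℕ → ℕ → ℕ
reflectedCount m L r = pred (m + L) C (L + r)

-- The number of ordered preference lists of m cars over L spaces, the first d of them already occupied,
-- with at least r flaws: the L ∸ d free spaces force m ∸ (L ∸ d) flaws, and more flaws are counted
-- by the reflection principle.
flawCount : ℕ → ℕ → ℕ → ℕ → ℕ
flawCount m L d r = if does (r ≤? forced m L d) then orderedCount m L else reflectedCount m L r

flawCount-forced : ∀ m L d {r} → r ≤ forced m L d → flawCount m L d r ≡ orderedCount m L
flawCount-forced m L d {r} r≤f rewrite dec-true (r ≤? forced m L d) r≤f = refl

flawCount-free : ∀ m L d {r} → forced m L d < r → flawCount m L d r ≡ reflectedCount m L r
flawCount-free m L d {r} f<r rewrite dec-false (r ≤? forced m L d) (<⇒≱ f<r) = refl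

orderedCount-pascal : ∀ m L →
  orderedCount (suc m) (suc L) ≡ orderedCount m (suc L) + orderedCount (suc m) L
orderedCount-pascal m L rewrite +-suc m L = pascal (m + L) m

reflectedCount-pascal : ∀ m L r →
  reflectedCount (suc m) (suc L) r ≡ reflectedCount m (suc L) r + reflectedCount (suc m) L r
reflectedCount-pascal m L r rewrite +-suc m L = trans (pascal (m + L) (L + r)) (+-comm ((m + L) C (L + r)) _)

reflectedCount-vanish : ∀ {m} L {r} → m < r → reflectedCount m L r ≡ 0
reflectedCount-vanish {m} L {r} m<r =
  k>n⇒nCk≡0 (≤-<-trans pred[n]≤n (subst (_< L + r) (+-comm L m) (+-monoʳ-< L m<r)))

flawCount-impossible : ∀ {m} L d {r} → m < r → flawCount m L d r ≡ 0
flawCount-impossible {m} L d m<r =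
  trans (flawCount-free m L d (≤-<-trans (m∸n≤m m (L ∸ d)) m<r)) (reflectedCount-vanish L m<r)

flawCount-pascal : ∀ m L d r {x y} →
  (r ≤ forced (suc m) (suc L) d → x ≡ orderedCount m (suc L) × y ≡ orderedCount (suc m) L) →
  (forced (suc m) (suc L) d < r → x ≡ reflectedCount m (suc L) r × y ≡ reflectedCount (suc m) L r) →
  flawCount (suc m) (suc L) d r ≡ x + y
flawCount-pascal m L d r forcedCase freeCase with r ≤? forced (suc m) (suc L) d
... | yes r≤f = trans (flawCount-forced (suc m) (suc L) d r≤f)
                      (trans (orderedCount-pascal m L) (sym (uncurry (cong₂ _+_) (forcedCase r≤f))))
... | no r≰f = trans (flawCount-free (suc m) (suc L) d (≰⇒> r≰f))
                     (trans (reflectedCount-pascal m L r) (sym (uncurry (cong₂ _+_) (freeCase (≰⇒> r≰f)))))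

squeeze-∸ : ∀ m n r → m ∸ n < r → r ≤ suc m ∸ n → n + r ≡ suc m
squeeze-∸ m zero r m<r r≤m = ≤-antisym r≤m m<r
squeeze-∸ zero (suc n) r 0<r r≤0 rewrite 0∸n≡0 n = contradiction r≤0 (<⇒≱ 0<r)
squeeze-∸ (suc m) (suc n) r lt le = cong suc (squeeze-∸ m n r lt le)

-- With d = 0 a further car raises the forced count m ∸ L by one (L ∸ 0 does not shrink); on that
-- boundary the two closed forms coincide.
flawCount-vacant : ∀ m L {r} → m ∸ L < r → flawCount (suc m) L 0 r ≡ reflectedCount (suc m) L r
flawCount-vacant m L {r} m∸L<r with r ≤? suc m ∸ L
... | yes r≤f = trans (flawCount-forced (suc m) L 0 r≤f) (cong ((m + L) C_) (sym (squeeze-∸ m L r m∸L<r r≤f)))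
... | no r≰f = flawCount-free (suc m) L 0 (≰⇒> r≰f)

flawCount-parks : ∀ m L d r → d ≤ L →
  flawCount (suc m) (suc L) d r ≡ flawCount m (suc L) (suc d) r + flawCount (suc m) L (pred d) r
flawCount-parks m L zero r _ = flawCount-pascal m L 0 r
  (λ r≤f → flawCount-forced m (suc L) 1 r≤f
         , flawCount-forced (suc m) L 0 (≤-trans r≤f (∸-monoˡ-≤ L (n≤1+n m))))
  (λ f<r → flawCount-free m (suc L) 1 f<r , flawCount-vacant m L f<r)
flawCount-parks m L (suc d) r d<L = flawCount-pascal m L (suc d) r
  (λ r≤f → flawCount-forced m (suc L) (suc (suc d)) (subst (r ≤_) same r≤f) , flawCount-forced (suc m) L d r≤f)
  (λ f<r → flawCount-free m (suc L) (suc (suc d)) (subst (_< r) same f<r) , flawCount-free (suc m) L d f<r)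
  where
    same : forced (suc m) (suc L) (suc d) ≡ forced m (suc L) (suc (suc d))
    same = cong (suc m ∸_) (+-∸-assoc 1 d<L)

flawCount-fails : ∀ m L d r → L < d →
  flawCount (suc m) (suc L) d r ≡ flawCount m (suc L) d (pred r) + flawCount (suc m) L (pred d) r
flawCount-fails m L d r L<d = flawCount-pascal m L d r
  (λ r≤f → flawCount-forced m (suc L) d (subst (pred r ≤_) (sym (cong (m ∸_) full)) (pred-mono-≤ (toAll r≤f)))
         , flawCount-forced (suc m) L (pred d) (subst (r ≤_) (sym (cong (suc m ∸_) full′)) (toAll r≤f)))
  (λ f<r → let m+1<r = subst (_< r) allForced f<r in
      trans (flawCount-impossible (suc L) d (pred-mono-≤ m+1<r))
            (sym (reflectedCount-vanish (suc L) (<-trans (n<1+n m) m+1<r)))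
    , trans (flawCount-impossible L (pred d) m+1<r) (sym (reflectedCount-vanish L m+1<r)))
  where
    full : suc L ∸ d ≡ 0
    full = m≤n⇒m∸n≡0 L<d
    full′ : L ∸ pred d ≡ 0
    full′ = m≤n⇒m∸n≡0 (pred-mono-≤ L<d)
    allForced : forced (suc m) (suc L) d ≡ suc m
    allForced = cong (suc m ∸_) full
    toAll : ∀ {r} → r ≤ forced (suc m) (suc L) d → r ≤ suc m
    toAll {r} = subst (r ≤_) allForced

flawCount-noSpaces : ∀ m d r → flawCount (suc m) 0 d r ≡ 0
flawCount-noSpaces m d r with r ≤? suc m
... | yes r≤m+1 = trans (flawCount-forced (suc m) 0 d (subst (r ≤_) (sym (cong (suc m ∸_) (0∸n≡0 d))) r≤m+1))
                        (k>n⇒nCk≡0 (s≤s (≤-reflexive (+-identityʳ m))))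
... | no r≰m+1 = flawCount-impossible 0 d (≰⇒> r≰m+1)

flawCount-initial : ∀ n k → flawCount n n 0 k ≡ pred (n + n) C (n + k)
flawCount-initial n zero = trans (flawCount-forced n n 0 z≤n) (cong (pred (n + n) C_) (sym (+-identityʳ n)))
flawCount-initial n (suc k) = flawCount-free n n 0 (subst (_< suc k) (sym (n∸n≡0 n)) (s≤s z≤n))

count : {A : Set} → (A → Bool) → List A → ℕ
count P xs = length (filterᵇ P xs)

count-++ : ∀ {A : Set} (P : A → Bool) xs ys → count P (xs ++ ys) ≡ count P xs + count P ys
count-++ P xs ys = trans (cong length (filter-++ (T? ∘ P) xs ys)) (length-++ (filterᵇ P xs))

count-concatMap : ∀ {A B : Set} (P : B → Bool) (f : A → List B) xs →
  count P (concatMap f xs) ≡ sum (map (count P ∘ f) xs)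
count-concatMap P f [] = refl
count-concatMap P f (x ∷ xs) =
  trans (count-++ P (f x) (concatMap f xs)) (cong (_+_ (count P (f x))) (count-concatMap P f xs))

count-map : ∀ {A B : Set} (P : B → Bool) (f : A → B) xs → count P (map f xs) ≡ count (P ∘ f) xs
count-map P f [] = refl
count-map P f (x ∷ xs) with P (f x)
... | true = cong suc (count-map P f xs)
... | false = count-map P f xs

count-cong : ∀ {A : Set} {P Q : A → Bool} → (∀ x → P x ≡ Q x) → ∀ xs → count P xs ≡ count Q xs
count-cong P≗Q [] = refl
count-cong {P = P} {Q} P≗Q (x ∷ xs) with P x | Q x | P≗Q x
... | true | true | _ = cong suc (count-cong P≗Q xs)
... | false | false | _ = count-cong P≗Q xs

count-singleton : ∀ {A : Set} (P : A → Bool) x → count P (x ∷ []) ≡ (if P x then 1 else 0)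
count-singleton P x with P x
... | true = refl
... | false = refl

count-none : ∀ {A : Set} (xs : List A) → count (λ _ → false) xs ≡ 0
count-none [] = refl
count-none (x ∷ xs) = count-none xs

tabulate-applyUpTo : ∀ {A : Set} n {g : Fin n → A} (h : ℕ → A) →
  (∀ i → g i ≡ h (toℕ i)) → tabulate g ≡ applyUpTo h n
tabulate-applyUpTo zero h g≗h = refl
tabulate-applyUpTo (suc n) h g≗h = cong₂ _∷_ (g≗h Fin.zero) (tabulate-applyUpTo n (h ∘ suc) (g≗h ∘ Fin.suc))

-- Defined by recursion rather than as in onlyFrom-≤ᵇ, so that shifting lo and a together is definitional.
onlyFrom : ℕ → (ℕ → ℕ) → ℕ → ℕ
onlyFrom zero g a = g a
onlyFrom (suc lo) g zero = 0
onlyFrom (suc lo) g (suc a) = onlyFrom lo (g ∘ suc) a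

onlyFrom-≤ᵇ : ∀ lo g a → onlyFrom lo g a ≡ (if lo ≤ᵇ a then g a else 0)
onlyFrom-≤ᵇ zero g a = refl
onlyFrom-≤ᵇ (suc lo) g zero = refl
onlyFrom-≤ᵇ (suc zero) g (suc a) = refl
onlyFrom-≤ᵇ (suc (suc lo)) g (suc a) = onlyFrom-≤ᵇ (suc lo) (g ∘ suc) a

sum-onlyFrom-≥ : ∀ n lo g → n ≤ lo → sum (applyUpTo (onlyFrom lo g) n) ≡ 0
sum-onlyFrom-≥ zero lo g _ = refl
sum-onlyFrom-≥ (suc n) (suc lo) g (s≤s n≤lo) = sum-onlyFrom-≥ n lo (g ∘ suc) n≤lo

sum-onlyFrom-< : ∀ n lo g → lo < n →
  sum (applyUpTo (onlyFrom lo g) n) ≡ g lo + sum (applyUpTo (onlyFrom (suc lo) g) n)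
sum-onlyFrom-< (suc n) zero g _ = refl
sum-onlyFrom-< (suc n) (suc lo) g (s≤s lo<n) = sum-onlyFrom-< n lo (g ∘ suc) lo<n

memb-here : ∀ x ys → memb x (x ∷ ys) ≡ true
memb-here x ys = cong (_∨ memb x ys) (dec-true (x ≟ x) refl)

memb-there : ∀ {x y} ys → x ≢ y → memb x (y ∷ ys) ≡ memb x ys
memb-there {x} {y} ys x≢y = cong (_∨ memb x ys) (dec-false (x ≟ y) x≢y)

below-first-free : ∀ {lo q x} → lo ≤ x → x < lo + (q ∸ lo) → x < q
below-first-free {lo} {q} lo≤x x<j with ≤-total lo q
... | inj₁ lo≤q = subst (_ <_) (m+[n∸m]≡n lo≤q) x<j
... | inj₂ q≤lo =
  contradiction (subst (_ <_) (trans (cong (_+_ lo) (m≤n⇒m∸n≡0 q≤lo)) (+-identityʳ lo)) x<j) (≤⇒≯ lo≤x)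

-- Nothing is claimed below lo: an ordered preference list never revisits those spaces.
record Block (lo q : ℕ) (occ : List ℕ) : Set where
  field
    occupied : ∀ x → lo ≤ x → x < q → memb x occ ≡ true
    vacant   : ∀ x → q ≤ x → memb x occ ≡ false
open Block

∸≡suc∸suc : ∀ {j q} → j < q → q ∸ j ≡ suc (q ∸ suc j)
∸≡suc∸suc = +-∸-assoc 1

-- j + (q ∸ j) is the larger of j and q, the first free space from j on.
freeFrom-block : ∀ {lo q occ j} f → Block lo q occ → lo ≤ j → q ∸ j < f →
  freeFrom occ j f ≡ just (j + (q ∸ j))
freeFrom-block {lo} {q} {occ} {j} (suc f) block lo≤j q∸j<f with j <? q
... | yes j<q rewrite occupied block j lo≤j j<q | ∸≡suc∸suc j<q | +-suc j (q ∸ suc j) =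
  freeFrom-block f block (m≤n⇒m≤1+n lo≤j) (s≤s⁻¹ q∸j<f)
... | no j≮q rewrite vacant block j (≮⇒≥ j≮q) | m≤n⇒m∸n≡0 (≮⇒≥ j≮q) =
  cong just (sym (+-identityʳ j))

freeFrom-block-full : ∀ {lo q occ j} f → Block lo q occ → lo ≤ j → f ≤ q ∸ j → freeFrom occ j f ≡ nothing
freeFrom-block-full zero block lo≤j f≤q∸j = refl
freeFrom-block-full {lo} {q} {occ} {j} (suc f) block lo≤j f<q∸j with j <? q
... | yes j<q rewrite occupied block j lo≤j j<q =
  freeFrom-block-full f block (m≤n⇒m≤1+n lo≤j) (s≤s⁻¹ (subst (suc f ≤_) (∸≡suc∸suc j<q) f<q∸j))
... | no j≮q = contradiction (subst (suc f ≤_) (m≤n⇒m∸n≡0 (≮⇒≥ j≮q)) f<q∸j) λ ()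

block-raise : ∀ {lo q occ} → Block lo q occ → Block (suc lo) q occ
block-raise block = record
  { occupied = λ x lo<x → occupied block x (<⇒≤ lo<x) ; vacant = vacant block }

block-park : ∀ {lo q occ} → Block lo q occ → Block lo (suc (lo + (q ∸ lo))) (lo + (q ∸ lo) ∷ occ)
block-park {lo} {q} {occ} block = record { occupied = occupied′ ; vacant = vacant′ }
  where
    j = lo + (q ∸ lo)
    occupied′ : ∀ x → lo ≤ x → x < suc j → memb x (j ∷ occ) ≡ true
    occupied′ x lo≤x x≤j with x ≟ j
    ... | yes refl = memb-here j occ
    ... | no x≢j = trans (memb-there occ x≢j)
                         (occupied block x lo≤x (below-first-free lo≤x (≤∧≢⇒< (s≤s⁻¹ x≤j) x≢j)))
    vacant′ : ∀ x → suc j ≤ x → memb x (j ∷ occ) ≡ false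
    vacant′ x j<x = trans (memb-there occ (λ x≡j → <-irrefl (sym x≡j) j<x))
                          (vacant block x (≤-trans (m≤n+m∸n q lo) (<⇒≤ j<x)))

module Counting (n k : ℕ) where

  orderedFrom : ℕ → List (Fin n) → Bool
  orderedFrom lo [] = true
  orderedFrom lo (a ∷ as) = (lo ≤ᵇ toℕ a) ∧ orderedFrom (toℕ a) as

  isOrdered-∷ : ∀ a as → isOrdered (a ∷ as) ≡ orderedFrom (toℕ a) as
  isOrdered-∷ a [] = refl
  isOrdered-∷ a (b ∷ as) = cong ((toℕ a ≤ᵇ toℕ b) ∧_) (isOrdered-∷ b as)

  isOrdered≡orderedFrom0 : ∀ p → isOrdered p ≡ orderedFrom 0 p
  isOrdered≡orderedFrom0 [] = refl
  isOrdered≡orderedFrom0 (a ∷ as) = isOrdered-∷ a as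

  settle : Maybe ℕ → List ℕ × ℕ → List ℕ × ℕ
  settle (just j) (occ , fl) = (j ∷ occ , fl)
  settle nothing (occ , fl) = (occ , suc fl)

  park : List ℕ × ℕ → ℕ → List ℕ × ℕ
  park (occ , fl) a = settle (freeFrom occ a (n ∸ a)) (occ , fl)

  parkAll-∷ : ∀ a as occ fl →
    parkAll n (a ∷ as) (occ , fl) ≡ parkAll n as (park (occ , fl) (toℕ a))
  parkAll-∷ a as occ fl with freeFrom occ (toℕ a) (n ∸ toℕ a)
  ... | just j = refl
  ... | nothing = refl

  flawedFrom : ℕ → List ℕ × ℕ → List (Fin n) → Bool
  flawedFrom lo st p = orderedFrom lo p ∧ (k ≤ᵇ proj₂ (parkAll n p st))

  countFlawed : ℕ → ℕ → List ℕ × ℕ → ℕ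
  countFlawed m lo st = count (flawedFrom lo st) (allPrefs m n)

  flawedFrom-∷ : ∀ lo occ fl a as →
    flawedFrom lo (occ , fl) (a ∷ as)
      ≡ (if lo ≤ᵇ toℕ a then flawedFrom (toℕ a) (park (occ , fl) (toℕ a)) as else false)
  flawedFrom-∷ lo occ fl a as rewrite parkAll-∷ a as occ fl with lo ≤ᵇ toℕ a
  ... | true = refl
  ... | false = refl

  countFlawed-suc : ∀ m lo occ fl →
    countFlawed (suc m) lo (occ , fl)
      ≡ sum (applyUpTo (onlyFrom lo (λ a → countFlawed m a (park (occ , fl) a))) n)
  countFlawed-suc m lo occ fl = begin
    countFlawed (suc m) lo (occ , fl)
      ≡⟨ count-concatMap (flawedFrom lo (occ , fl)) (λ a → map (a ∷_) (allPrefs m n)) (allFin n) ⟩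
    sum (map (λ a → count (flawedFrom lo (occ , fl)) (map (a ∷_) (allPrefs m n))) (allFin n))
      ≡⟨ cong sum (trans (map-tabulate id _) (tabulate-applyUpTo n _ byFirstPreference)) ⟩
    sum (applyUpTo (onlyFrom lo (λ a → countFlawed m a (park (occ , fl) a))) n) ∎
    where
      open ≡-Reasoning
      byFirstPreference : ∀ a → count (flawedFrom lo (occ , fl)) (map (a ∷_) (allPrefs m n))
                              ≡ onlyFrom lo (λ a → countFlawed m a (park (occ , fl) a)) (toℕ a)
      byFirstPreference a rewrite count-map (flawedFrom lo (occ , fl)) (a ∷_) (allPrefs m n)
                                | onlyFrom-≤ᵇ lo (λ a → countFlawed m a (park (occ , fl) a)) (toℕ a)
                                | count-cong (flawedFrom-∷ lo occ fl a) (allPrefs m n)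
                                with lo ≤ᵇ toℕ a
      ... | true = refl
      ... | false = count-none (allPrefs m n)

  ClosedForm : ℕ → Set
  ClosedForm m = ∀ lo q occ fl → lo ≤ n → Block lo q occ →
    countFlawed m lo (occ , fl) ≡ flawCount m (n ∸ lo) (q ∸ lo) (k ∸ fl)

  closedForm-zero : ClosedForm 0
  closedForm-zero lo q occ fl _ _ with k ≤? fl
  ... | yes k≤fl = begin
    countFlawed 0 lo (occ , fl)      ≡⟨ count-singleton (flawedFrom lo (occ , fl)) [] ⟩
    (if k ≤ᵇ fl then 1 else 0)       ≡⟨ cong (λ b → if b then 1 else 0) (dec-true (k ≤? fl) k≤fl) ⟩
    flawCount 0 (n ∸ lo) (q ∸ lo) 0  ≡⟨ cong (flawCount 0 (n ∸ lo) (q ∸ lo)) (m≤n⇒m∸n≡0 k≤fl) ⟨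
    flawCount 0 (n ∸ lo) (q ∸ lo) (k ∸ fl) ∎
    where open ≡-Reasoning
  ... | no k≰fl = begin
    countFlawed 0 lo (occ , fl)      ≡⟨ count-singleton (flawedFrom lo (occ , fl)) [] ⟩
    (if k ≤ᵇ fl then 1 else 0)       ≡⟨ cong (λ b → if b then 1 else 0) (dec-false (k ≤? fl) k≰fl) ⟩
    0                                ≡⟨ flawCount-impossible (n ∸ lo) (q ∸ lo) (m<n⇒0<n∸m (≰⇒> k≰fl)) ⟨
    flawCount 0 (n ∸ lo) (q ∸ lo) (k ∸ fl) ∎
    where open ≡-Reasoning

  spacesLeft : ∀ {lo t} → lo + t ≡ n → n ∸ lo ≡ t
  spacesLeft {lo} {t} e = trans (cong (_∸ lo) (sym e)) (m+n∸m≡n lo t)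

  firstCar-parks : ∀ {m} → ClosedForm m →
    ∀ {lo q occ fl t} → lo + suc t ≡ n → Block lo q occ → q ∸ lo ≤ t →
    countFlawed m lo (park (occ , fl) lo) ≡ flawCount m (suc t) (suc (q ∸ lo)) (k ∸ fl)
  firstCar-parks {m} ih {lo} {q} {occ} {fl} {t} e block q∸lo≤t = begin
    countFlawed m lo (park (occ , fl) lo)
      ≡⟨ cong (λ r → countFlawed m lo (settle r (occ , fl)))
              (freeFrom-block (n ∸ lo) block ≤-refl (subst (q ∸ lo <_) (sym (spacesLeft e)) (s≤s q∸lo≤t))) ⟩
    countFlawed m lo (lo + (q ∸ lo) ∷ occ , fl)
      ≡⟨ ih lo _ _ fl (subst (lo ≤_) e (m≤m+n lo (suc t))) (block-park block) ⟩
    flawCount m (n ∸ lo) (suc (lo + (q ∸ lo)) ∸ lo) (k ∸ fl)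
      ≡⟨ cong₂ (λ L d → flawCount m L d (k ∸ fl))
               (spacesLeft e) (trans (cong (_∸ lo) (sym (+-suc lo (q ∸ lo)))) (m+n∸m≡n lo _)) ⟩
    flawCount m (suc t) (suc (q ∸ lo)) (k ∸ fl) ∎
    where open ≡-Reasoning

  firstCar-fails : ∀ {m} → ClosedForm m →
    ∀ {lo q occ fl t} → lo + suc t ≡ n → Block lo q occ → t < q ∸ lo →
    countFlawed m lo (park (occ , fl) lo) ≡ flawCount m (suc t) (q ∸ lo) (pred (k ∸ fl))
  firstCar-fails {m} ih {lo} {q} {occ} {fl} {t} e block t<q∸lo = begin
    countFlawed m lo (park (occ , fl) lo)
      ≡⟨ cong (λ r → countFlawed m lo (settle r (occ , fl)))
              (freeFrom-block-full (n ∸ lo) block ≤-refl (subst (_≤ q ∸ lo) (sym (spacesLeft e)) t<q∸lo)) ⟩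
    countFlawed m lo (occ , suc fl)
      ≡⟨ ih lo q occ (suc fl) (subst (lo ≤_) e (m≤m+n lo (suc t))) block ⟩
    flawCount m (n ∸ lo) (q ∸ lo) (k ∸ suc fl)
      ≡⟨ cong₂ (λ L r → flawCount m L (q ∸ lo) r) (spacesLeft e) (sym (pred[m∸n]≡m∸[1+n] k fl)) ⟩
    flawCount m (suc t) (q ∸ lo) (pred (k ∸ fl)) ∎
    where open ≡-Reasoning

  closedForm-suc : ∀ {m} → ClosedForm m → ClosedForm (suc m)
  closedForm-suc {m} ih lo q occ fl lo≤n block =
    trans (countFlawed-suc m lo occ fl) (carsFrom (n ∸ lo) lo (m+[n∸m]≡n lo≤n) block)
    where
      firstCar : ℕ → ℕ
      firstCar a = countFlawed m a (park (occ , fl) a)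

      byFirstCar : ∀ {lo t} → lo + suc t ≡ n → Block lo q occ →
        firstCar lo + flawCount (suc m) t (pred (q ∸ lo)) (k ∸ fl) ≡ flawCount (suc m) (suc t) (q ∸ lo) (k ∸ fl)
      byFirstCar {lo} {t} e block with q ∸ lo ≤? t
      ... | yes parks = trans (cong (_+ _) (firstCar-parks ih e block parks))
                              (sym (flawCount-parks m t (q ∸ lo) (k ∸ fl) parks))
      ... | no fails = trans (cong (_+ _) (firstCar-fails ih e block (≰⇒> fails)))
                             (sym (flawCount-fails m t (q ∸ lo) (k ∸ fl) (≰⇒> fails)))

      carsFrom : ∀ t lo → lo + t ≡ n → Block lo q occ →
        sum (applyUpTo (onlyFrom lo firstCar) n) ≡ flawCount (suc m) t (q ∸ lo) (k ∸ fl)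
      carsFrom zero lo e _ = trans (sum-onlyFrom-≥ n lo firstCar (≤-reflexive (trans (sym e) (+-identityʳ lo))))
                                   (sym (flawCount-noSpaces m (q ∸ lo) (k ∸ fl)))
      carsFrom (suc t) lo e block = begin
        sum (applyUpTo (onlyFrom lo firstCar) n)
          ≡⟨ sum-onlyFrom-< n lo firstCar (subst (lo <_) e (m<m+n lo z<s)) ⟩
        firstCar lo + sum (applyUpTo (onlyFrom (suc lo) firstCar) n)
          ≡⟨ cong (_+_ (firstCar lo)) (carsFrom t (suc lo) (trans (sym (+-suc lo t)) e) (block-raise block)) ⟩
        firstCar lo + flawCount (suc m) t (q ∸ suc lo) (k ∸ fl)
          ≡⟨ cong (λ d → firstCar lo + flawCount (suc m) t d (k ∸ fl)) (pred[m∸n]≡m∸[1+n] q lo) ⟨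
        firstCar lo + flawCount (suc m) t (pred (q ∸ lo)) (k ∸ fl)
          ≡⟨ byFirstCar e block ⟩
        flawCount (suc m) (suc t) (q ∸ lo) (k ∸ fl) ∎
        where open ≡-Reasoning

  closedForm : ∀ m → ClosedForm m
  closedForm zero = closedForm-zero
  closedForm (suc m) = closedForm-suc (closedForm m)

op≥-closedForm : ∀ n k → op≥ n k ≡ pred (n + n) C (n + k)
op≥-closedForm n k = begin
  op≥ n k                  ≡⟨ count-cong (λ p → cong (_∧ (k ≤ᵇ flaws n p)) (isOrdered≡orderedFrom0 p)) (allPrefs n n) ⟩
  countFlawed n 0 ([] , 0) ≡⟨ closedForm n 0 0 [] 0 z≤n emptyBlock ⟩
  flawCount n n 0 k        ≡⟨ flawCount-initial n k ⟩
  pred (n + n) C (n + k)   ∎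
  where
    open Counting n k
    open ≡-Reasoning
    emptyBlock : Block 0 0 []
    emptyBlock = record { occupied = λ _ _ () ; vacant = λ _ _ → refl }

coeff-+ₚ : ∀ p q i → coeff (p +ₚ q) i ≡ coeff p i ℤ.+ coeff q i
coeff-+ₚ [] q i = sym (ℤP.+-identityˡ (coeff q i))
coeff-+ₚ (c ∷ cs) [] zero = sym (ℤP.+-identityʳ c)
coeff-+ₚ (c ∷ cs) [] (suc i) = sym (ℤP.+-identityʳ (coeff cs i))
coeff-+ₚ (c ∷ cs) (d ∷ ds) zero = refl
coeff-+ₚ (c ∷ cs) (d ∷ ds) (suc i) = coeff-+ₚ cs ds i

coeff-·ₚ : ∀ a p i → coeff (a ·ₚ p) i ≡ a ℤ.* coeff p i
coeff-·ₚ a [] i = sym (ℤP.*-zeroʳ a)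
coeff-·ₚ a (c ∷ cs) zero = refl
coeff-·ₚ a (c ∷ cs) (suc i) = coeff-·ₚ a cs i

-- conv cs f i = Σ_{j ≤ i} cs_j * f (i - j); the singleton clause lets conv reduce on a concrete cs
-- even at a variable index.
conv : List ℤ → (ℕ → ℤ) → ℕ → ℤ
conv [] f i = 0ℤ
conv (c ∷ []) f i = c ℤ.* f i
conv (c ∷ d ∷ cs) f zero = c ℤ.* f zero
conv (c ∷ d ∷ cs) f (suc i) = c ℤ.* f (suc i) ℤ.+ conv (d ∷ cs) f i

conv-cong : ∀ cs {f g : ℕ → ℤ} → (∀ i → f i ≡ g i) → ∀ i → conv cs f i ≡ conv cs g i
conv-cong [] f≗g i = refl
conv-cong (c ∷ []) f≗g i = cong (c ℤ.*_) (f≗g i)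
conv-cong (c ∷ d ∷ cs) f≗g zero = cong (c ℤ.*_) (f≗g zero)
conv-cong (c ∷ d ∷ cs) f≗g (suc i) = cong₂ ℤ._+_ (cong (c ℤ.*_) (f≗g (suc i))) (conv-cong (d ∷ cs) f≗g i)

coeff-*ₚ : ∀ cs q i → coeff (cs *ₚ q) i ≡ conv cs (coeff q) i
coeff-*ₚ [] q i = refl
coeff-*ₚ (c ∷ []) q i = begin
  coeff (c ·ₚ q +ₚ (0ℤ ∷ [])) i          ≡⟨ coeff-+ₚ (c ·ₚ q) (0ℤ ∷ []) i ⟩
  coeff (c ·ₚ q) i ℤ.+ coeff (0ℤ ∷ []) i ≡⟨ cong₂ ℤ._+_ (coeff-·ₚ c q i) (coeff-0∷[] i) ⟩
  c ℤ.* coeff q i ℤ.+ 0ℤ                 ≡⟨ ℤP.+-identityʳ _ ⟩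
  c ℤ.* coeff q i                        ∎
  where
    open ≡-Reasoning
    coeff-0∷[] : ∀ i → coeff (0ℤ ∷ []) i ≡ 0ℤ
    coeff-0∷[] zero = refl
    coeff-0∷[] (suc i) = refl
coeff-*ₚ (c ∷ d ∷ cs) q zero =
  trans (coeff-+ₚ (c ·ₚ q) _ zero) (trans (cong (ℤ._+ 0ℤ) (coeff-·ₚ c q zero)) (ℤP.+-identityʳ _))
coeff-*ₚ (c ∷ d ∷ cs) q (suc i) =
  trans (coeff-+ₚ (c ·ₚ q) _ (suc i)) (cong₂ ℤ._+_ (coeff-·ₚ c q (suc i)) (coeff-*ₚ (d ∷ cs) q i))

coeff-applyUpTo : ∀ n {f} (F : ℕ → ℤ) → (∀ j → j < n → f j ≡ F j) → (∀ j → n ≤ j → F j ≡ 0ℤ) →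
  ∀ i → coeff (applyUpTo f n) i ≡ F i
coeff-applyUpTo zero F f≗F vanish i = sym (vanish i z≤n)
coeff-applyUpTo (suc n) F f≗F vanish zero = f≗F zero (s≤s z≤n)
coeff-applyUpTo (suc n) F f≗F vanish (suc i) =
  coeff-applyUpTo n (F ∘ suc) (λ j j<n → f≗F (suc j) (s≤s j<n)) (λ j n≤j → vanish (suc j) (s≤s n≤j)) i

row : ℕ → ℕ → ℕ
row n i = (n + suc n) C (suc n + i)

coeff-ψ : ∀ n i → coeff (ψ (suc n)) i ≡ + row n i
coeff-ψ n i = begin
  coeff (ψ (suc n)) i
    ≡⟨ cong (λ l → coeff l i) (map-upTo _ (suc n)) ⟩
  coeff (applyUpTo (λ k → + op≥ (suc n) k) (suc n)) i
    ≡⟨ coeff-applyUpTo (suc n) (+_ ∘ row n) (λ j _ → cong +_ (op≥-closedForm (suc n) j)) vanish i ⟩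
  + row n i ∎
  where
    open ≡-Reasoning
    vanish : ∀ j → suc n ≤ j → + row n j ≡ 0ℤ
    vanish j n<j = cong +_ (k>n⇒nCk≡0 (s≤s (+-monoʳ-≤ n n<j)))

coeff-*ₚψ : ∀ cs n i → coeff (cs *ₚ ψ (suc n)) i ≡ conv cs (+_ ∘ row n) i
coeff-*ₚψ cs n i = trans (coeff-*ₚ cs (ψ (suc n)) i) (conv-cong cs (coeff-ψ n) i)

pascal² : ∀ m k → suc (suc m) C suc (suc k) ≡ m C k + 2 * (m C suc k) + m C suc (suc k)
pascal² m k = begin
  suc (suc m) C suc (suc k)                 ≡⟨ pascal (suc m) (suc k) ⟩
  suc m C suc k + suc m C suc (suc k)       ≡⟨ cong₂ _+_ (pascal m k) (pascal m (suc k)) ⟩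
  m C k + m C suc k + (m C suc k + m C suc (suc k))
    ≡⟨ regroup (m C k) (m C suc k) (m C suc (suc k)) ⟩
  m C k + 2 * (m C suc k) + m C suc (suc k) ∎
  where
    open ≡-Reasoning
    regroup : ∀ x y z → x + y + (y + z) ≡ x + 2 * y + z
    regroup = ℕ-Ring.solve-∀

middle-symmetric : ∀ n → (n + suc n) C n ≡ (n + suc n) C suc n
middle-symmetric n = trans (nCk≡nC[n∸k] (m≤m+n n (suc n))) (cong ((n + suc n) C_) (m+n∸m≡n n (suc n)))

row-pascal : ∀ n j → row (suc n) (suc j) ≡ row n j + 2 * row n (suc j) + row n (suc (suc j))
row-pascal n j rewrite +-suc n (suc n) | +-suc n (suc j) | +-suc n j = pascal² (n + suc n) (suc (n + j))

-- At the constant term the symmetry of row 2n + 1 supplies the missing coefficient of x⁻¹.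
row-pascal₀ : ∀ n → row (suc n) 0 ≡ row n 0 + 2 * row n 0 + row n 1
row-pascal₀ n rewrite +-suc n (suc n) | +-suc n 0 | +-identityʳ n =
  trans (pascal² (n + suc n) n)
        (cong (λ x → x + 2 * ((n + suc n) C suc n) + (n + suc n) C suc (suc n)) (middle-symmetric n))

central : ∀ n → (2 * suc (suc n) ∸ 2) C suc n ≡ 2 * row n 0
central n rewrite +-identityʳ n | +-suc n (suc n) =
  trans (pascal (n + suc n) n) (cong₂ _+_ (middle-symmetric n) (sym (+-identityʳ ((n + suc n) C suc n))))

pos-pascal : ∀ x y z → + (x + 2 * y + z) ≡ + x ℤ.+ + 2 ℤ.* + y ℤ.+ + z
pos-pascal x y z =
  trans (ℤP.pos-+ (x + 2 * y) z) (cong (ℤ._+ + z) (trans (ℤP.pos-+ x (2 * y)) (cong (ℤ._+_ (+ x)) (ℤP.pos-* 2 y))))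

recurrence-conv : ∀ (α β : ℕ → ℕ) c → c ≡ 2 * α 0 →
  β 0 ≡ α 0 + 2 * α 0 + α 1 → (∀ j → β (suc j) ≡ α j + 2 * α (suc j) + α (suc (suc j))) →
  ∀ i → conv (0ℤ ∷ + 2 ∷ []) (+_ ∘ β) i
        ≡ conv (+ 2 ∷ + 4 ∷ + 2 ∷ []) (+_ ∘ α) i ℤ.+ conv (-1ℤ ∷ 1ℤ ∷ []) (coeff (const (+ c))) i
recurrence-conv α β _ refl β₀ βₛ zero =
  trans (at0 (+ β 0) (+ α 0)) (cong (λ x → + 2 ℤ.* + α 0 ℤ.+ -1ℤ ℤ.* x) (sym (ℤP.pos-* 2 (α 0))))
  where
    at0 : ∀ x y → 0ℤ ℤ.* x ≡ + 2 ℤ.* y ℤ.+ -1ℤ ℤ.* (+ 2 ℤ.* y)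
    at0 = solve-∀
recurrence-conv α β _ refl β₀ βₛ (suc zero) = begin
  0ℤ ℤ.* + β 1 ℤ.+ + 2 ℤ.* + β 0
    ≡⟨ cong (λ x → 0ℤ ℤ.* + β 1 ℤ.+ + 2 ℤ.* x) (trans (cong +_ β₀) (pos-pascal (α 0) (α 0) (α 1))) ⟩
  0ℤ ℤ.* + β 1 ℤ.+ + 2 ℤ.* (+ α 0 ℤ.+ + 2 ℤ.* + α 0 ℤ.+ + α 1)
    ≡⟨ at1 (+ β 1) (+ α 0) (+ α 1) ⟩
  + 2 ℤ.* + α 1 ℤ.+ + 4 ℤ.* + α 0 ℤ.+ (-1ℤ ℤ.* 0ℤ ℤ.+ 1ℤ ℤ.* (+ 2 ℤ.* + α 0))
    ≡⟨ cong (λ x → + 2 ℤ.* + α 1 ℤ.+ + 4 ℤ.* + α 0 ℤ.+ (-1ℤ ℤ.* 0ℤ ℤ.+ 1ℤ ℤ.* x)) (ℤP.pos-* 2 (α 0)) ⟨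
  + 2 ℤ.* + α 1 ℤ.+ + 4 ℤ.* + α 0 ℤ.+ (-1ℤ ℤ.* 0ℤ ℤ.+ 1ℤ ℤ.* + (2 * α 0)) ∎
  where
    open ≡-Reasoning
    at1 : ∀ u v w → 0ℤ ℤ.* u ℤ.+ + 2 ℤ.* (v ℤ.+ + 2 ℤ.* v ℤ.+ w)
                  ≡ + 2 ℤ.* w ℤ.+ + 4 ℤ.* v ℤ.+ (-1ℤ ℤ.* 0ℤ ℤ.+ 1ℤ ℤ.* (+ 2 ℤ.* v))
    at1 = solve-∀
recurrence-conv α β _ refl β₀ βₛ (suc (suc j)) = begin
  0ℤ ℤ.* + β (suc (suc j)) ℤ.+ + 2 ℤ.* + β (suc j)
    ≡⟨ cong (λ x → 0ℤ ℤ.* + β (suc (suc j)) ℤ.+ + 2 ℤ.* x)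
            (trans (cong +_ (βₛ j)) (pos-pascal (α j) (α (suc j)) (α (suc (suc j))))) ⟩
  0ℤ ℤ.* + β (suc (suc j)) ℤ.+ + 2 ℤ.* (+ α j ℤ.+ + 2 ℤ.* + α (suc j) ℤ.+ + α (suc (suc j)))
    ≡⟨ atₛ (+ β (suc (suc j))) (+ α j) (+ α (suc j)) (+ α (suc (suc j))) ⟩
  + 2 ℤ.* + α (suc (suc j)) ℤ.+ (+ 4 ℤ.* + α (suc j) ℤ.+ + 2 ℤ.* + α j) ℤ.+ (-1ℤ ℤ.* 0ℤ ℤ.+ 1ℤ ℤ.* 0ℤ) ∎
  where
    open ≡-Reasoning
    atₛ : ∀ u x y z → 0ℤ ℤ.* u ℤ.+ + 2 ℤ.* (x ℤ.+ + 2 ℤ.* y ℤ.+ z)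
                    ≡ + 2 ℤ.* z ℤ.+ (+ 4 ℤ.* y ℤ.+ + 2 ℤ.* x) ℤ.+ (-1ℤ ℤ.* 0ℤ ℤ.+ 1ℤ ℤ.* 0ℤ)
    atₛ = solve-∀

mainTheorem14 : (n : ℕ) → 2 ≤ n →
    (const (+ 2) *ₚ X *ₚ ψ n)
      ≈ₚ ((const (+ 2) *ₚ (const 1ℤ +ₚ X) *ₚ (const 1ℤ +ₚ X) *ₚ ψ (n ∸ 1))
          +ₚ ((X +ₚ const -1ℤ) *ₚ const (+ ((2 * n ∸ 2) C (n ∸ 1)))))
mainTheorem14 (suc (suc n)) (s≤s (s≤s z≤n)) i = begin
  coeff (2X *ₚ ψ (suc (suc n))) i
    ≡⟨ coeff-*ₚψ 2X (suc n) i ⟩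
  conv 2X (+_ ∘ row (suc n)) i
    ≡⟨ recurrence-conv (row n) (row (suc n)) _ (central n) (row-pascal₀ n) (row-pascal n) i ⟩
  conv 2[1+X]² (+_ ∘ row n) i ℤ.+ conv [X-1] (coeff (const c)) i
    ≡⟨ cong₂ ℤ._+_ (coeff-*ₚψ 2[1+X]² n i) (coeff-*ₚ [X-1] (const c) i) ⟨
  coeff (2[1+X]² *ₚ ψ (suc n)) i ℤ.+ coeff ([X-1] *ₚ const c) i
    ≡⟨ coeff-+ₚ (2[1+X]² *ₚ ψ (suc n)) ([X-1] *ₚ const c) i ⟨
  coeff ((2[1+X]² *ₚ ψ (suc n)) +ₚ ([X-1] *ₚ const c)) i ∎
  where
    open ≡-Reasoning
    2X 2[1+X]² [X-1] : Poly
    2X = 0ℤ ∷ + 2 ∷ []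
    2[1+X]² = + 2 ∷ + 4 ∷ + 2 ∷ []
    [X-1] = -1ℤ ∷ 1ℤ ∷ []
    c : ℤ
    c = + ((2 * suc (suc n) ∸ 2) C suc n)
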